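{- Let $\Gamma$ be a set of closed predicates (patterns that are closed and are predicates). Then for every pattern $\varphi$: $\Gamma\models_g\varphi$ iff $\Gamma\models_l\varphi$ iff $\Gamma\models_s\varphi$.
   Context: Patterns over pairwise disjoint sets $EVar$ (element variables), $SVar$ (set variables) and constants $\Sigma$: $\varphi ::= x \mid X \mid \sigma \mid \varphi\,\varphi \mid \varphi\to\varphi \mid \exists x.\varphi \mid \mu X.\varphi$; a pattern is closed if it has no free variables. Structure $\mathcal A=(A,\cdot,(\sigma^{\mathcal A}))$: $A\ne\emptyset$, $\cdot:A\times A\to 2^A$, $\sigma^{\mathcal A}\subseteq A$; $B\cdot C:=\bigcup_{b\in B,c\in C}b\cdot c$. Valuations $e$; updates $e[a/x]$, $e[B/X]$. $\bar e(x)=\{e(x)\}$, $\bar e(X)=e(X)$, $\bar e(\sigma)=\sigma^{\mathcal A}$, $\bar e(\varphi\psi)=\bar e(\varphi)\cdot\bar e(\psi)$, $\bar e(\varphi\to\psi)=A\setminus(\bar e(\varphi)\setminus\bar e(\psi))$, $\bar e(\exists x.\varphi)=\bigcup_{a}\overline{e[a/x]}(\varphi)$, $\bar e(\mu X.\varphi)=\bigcap\{B\subseteq A:\overline{e[B/X]}(\varphi)\subseteq B\}$. A pattern $\varphi$ is a predicate if $\bar e(\varphi)\in\{\emptyset,A\}$ for every structure $\mathcal A$ and every $\mathcal A$-valuation $e$. $\mathcal A\models\varphi[e]$ means $\bar e(\varphi)=A$; $\mathcal A\models\varphi$ means this for all $e$. $\Gamma\models_g\varphi$: every $\mathcal A$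 with $\mathcal A\models\gamma$ for all $\gamma\in\Gamma$ satisfies $\mathcal A\models\varphi$. $\Gamma\models_l\varphi$: for all $\mathcal A,e$, if $\mathcal A\models\gamma[e]$ for all $\gamma\in\Gamma$ then $\mathcal A\models\varphi[e]$. $\Gamma\models_s\varphi$: for all $\mathcal A,e$, $\bigcap_{\gamma\in\Gamma}\bar e(\gamma)\subseteq\bar e(\varphi)$ (empty intersection $=A$). -}

module Defs where

open import Level using (Level; Lift; lift) renaming (zero to lzero; suc to lsuc)
open import Data.Nat using (ℕ; _≟_)
open import Data.Product using (Σ; ∃; ∃-syntax; _×_; _,_)
open import Data.Sum using (_⊎_)
open import Data.Empty using (⊥)
open import Relation.Nullary using (¬_; yes; no)
open import Relation.Binary.PropositionalEquality using (_≡_)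

-- Element variables and set variables: both countably infinite, here ℕ
-- (they live in separate constructors, hence are disjoint).
EVar : Set
EVar = ℕ

SVar : Set
SVar = ℕ

data Pattern (Sig : Set) : Set where
  evar : EVar → Pattern Sig
  svar : SVar → Pattern Sig
  sym  : Sig → Pattern Sig
  app  : Pattern Sig → Pattern Sig → Pattern Sig
  imp  : Pattern Sig → Pattern Sig → Pattern Sig
  ex   : EVar → Pattern Sig → Pattern Sig
  mu   : SVar → Pattern Sig → Pattern Sig

module _ {Sig : Set} where

  data FreeE (x : EVar) : Pattern Sig → Set where
    fe-var  : FreeE x (evar x)
    fe-appˡ : ∀ {φ ψ} → FreeE x φ → FreeE x (app φ ψ)
    fe-appʳ : ∀ {φ ψ} → FreeE x ψ → FreeE x (app φ ψ)
    fe-impˡ : ∀ {φ ψ} → FreeE x φ → FreeE x (imp φ ψ)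
    fe-impʳ : ∀ {φ ψ} → FreeE x ψ → FreeE x (imp φ ψ)
    fe-ex   : ∀ {y φ} → ¬ (x ≡ y) → FreeE x φ → FreeE x (ex y φ)
    fe-mu   : ∀ {X φ} → FreeE x φ → FreeE x (mu X φ)

  data FreeS (X : SVar) : Pattern Sig → Set where
    fs-var  : FreeS X (svar X)
    fs-appˡ : ∀ {φ ψ} → FreeS X φ → FreeS X (app φ ψ)
    fs-appʳ : ∀ {φ ψ} → FreeS X ψ → FreeS X (app φ ψ)
    fs-impˡ : ∀ {φ ψ} → FreeS X φ → FreeS X (imp φ ψ)
    fs-impʳ : ∀ {φ ψ} → FreeS X ψ → FreeS X (imp φ ψ)
    fs-ex   : ∀ {y φ} → FreeS X φ → FreeS X (ex y φ)
    fs-mu   : ∀ {Y φ} → ¬ (X ≡ Y) → FreeS X φ → FreeS X (mu Y φ)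

  Closed : Pattern Sig → Set
  Closed φ = (∀ x → ¬ FreeE x φ) × (∀ X → ¬ FreeS X φ)

-- Structures: nonempty carrier A, application A × A → 2^A
-- (a ∈ b · c is written  _·_∋ b c a), and interpretations of constants.
-- Subsets of A are predicates A → Set.
record Structure (Sig : Set) : Set₁ where
  field
    Carrier  : Set
    inhabit  : Carrier
    _·_∋_    : Carrier → Carrier → Carrier → Set
    ⟦_⟧ˢ     : Sig → Carrier → Set

module _ {Sig : Set} (M : Structure Sig) where
  open Structure M

  record Valuation : Set₁ where
    field
      ev : EVar → Carrier
      sv : SVar → Carrier → Set
  open Valuation

  _[_/ₑ_] : Valuation → Carrier → EVar → Valuation
  ev (e [ a /ₑ x ]) y with y ≟ x
  ... | yes _ = a
  ... | no  _ = ev e y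
  sv (e [ a /ₑ x ]) = sv e

  _[_/ₛ_] : Valuation → (Carrier → Set) → SVar → Valuation
  ev (e [ B /ₛ X ]) = ev e
  sv (e [ B /ₛ X ]) Y with Y ≟ X
  ... | yes _ = B
  ... | no  _ = sv e Y

  Sat : Pattern Sig → Valuation → Carrier → Set₁
  Sat (evar x)  e a = Lift (lsuc lzero) (ev e x ≡ a)
  Sat (svar X)  e a = Lift (lsuc lzero) (sv e X a)
  Sat (sym σ)   e a = Lift (lsuc lzero) (⟦ σ ⟧ˢ a)
  Sat (app φ ψ) e a = ∃[ b ] ∃[ c ] (Sat φ e b × Sat ψ e c × Lift (lsuc lzero) (b · c ∋ a))
  Sat (imp φ ψ) e a = ¬ (Sat φ e a × ¬ Sat ψ e a)
  Sat (ex x φ)  e a = ∃[ b ] Sat φ (e [ b /ₑ x ]) a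
  Sat (mu X φ)  e a = (B : Carrier → Set)
                    → (∀ b → Sat φ (e [ B /ₛ X ]) b → Lift (lsuc lzero) (B b))
                    → Lift (lsuc lzero) (B a)

module _ {Sig : Set} where
  open Structure

  SatAt : (M : Structure Sig) → Pattern Sig → Valuation M → Set₁
  SatAt M φ e = ∀ a → Sat M φ e a

  Valid : Structure Sig → Pattern Sig → Set₁
  Valid M φ = ∀ e → SatAt M φ e

  IsPredicate : Pattern Sig → Set₁
  IsPredicate φ = ∀ (M : Structure Sig) (e : Valuation M)
                  → (∀ a → ¬ Sat M φ e a) ⊎ (∀ a → Sat M φ e a)

  _⊨g_ : (Pattern Sig → Set) → Pattern Sig → Set₁
  Γ ⊨g φ = ∀ (M : Structure Sig) → (∀ γ → Γ γ → Valid M γ) → Valid M φ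

  _⊨l_ : (Pattern Sig → Set) → Pattern Sig → Set₁
  Γ ⊨l φ = ∀ (M : Structure Sig) (e : Valuation M)
           → (∀ γ → Γ γ → SatAt M γ e) → SatAt M φ e

  _⊨s_ : (Pattern Sig → Set) → Pattern Sig → Set₁
  Γ ⊨s φ = ∀ (M : Structure Sig) (e : Valuation M) (a : Carrier M)
           → (∀ γ → Γ γ → Sat M γ e a) → Sat M φ e a

{-# OPTIONS --safe #-}
-- A closed pattern has the same extension under every valuation
-- (coincidence lemma), so validity of Γ in M and satisfaction of Γ at one
-- valuation coincide; a predicate has extension ∅ or A, so if it contains a
-- single point it is all of A, and pointwise satisfaction of Γ coincides with
-- satisfaction at the valuation.
module Submission where

open import Defs
open import Data.Product using (_×_; _,_; proj₁; proj₂)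
open import Data.Sum using (inj₁; inj₂)
open import Data.Empty using (⊥-elim)
open import Data.Nat using (_≟_)
open import Level using (lift)
open import Relation.Nullary using (yes; no)
open import Relation.Binary.PropositionalEquality using (_≡_; refl; subst)
  renaming (sym to ≡-sym)
open import Function.Base using (_∘_)
open import Function.Bundles using (_⇔_; mk⇔; Equivalence)
open import Function.Construct.Identity using (⇔-id)
open import Function.Construct.Symmetry using (⇔-sym)

module _ {Sig : Set} (M : Structure Sig) where
  open Structure M
  open Valuation

  record AgreeOn (φ : Pattern Sig) (e e′ : Valuation M) : Set where
    field
      on-evar : ∀ {x} → FreeE x φ → ev e x ≡ ev e′ x
      on-svar : ∀ {X} → FreeS X φ → ∀ b → sv e X b ⇔ sv e′ X b
  open AgreeOn

  AgreeOn-sym : ∀ {φ e e′} → AgreeOn φ e e′ → AgreeOn φ e′ e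
  on-evar (AgreeOn-sym agree) x∈φ = ≡-sym (on-evar agree x∈φ)
  on-svar (AgreeOn-sym agree) X∈φ b = ⇔-sym (on-svar agree X∈φ b)

  AgreeOn-mono : ∀ {φ ψ e e′}
               → (∀ {x} → FreeE x φ → FreeE x ψ) → (∀ {X} → FreeS X φ → FreeS X ψ)
               → AgreeOn ψ e e′ → AgreeOn φ e e′
  on-evar (AgreeOn-mono ⊆ₑ _ agree) x∈φ = on-evar agree (⊆ₑ x∈φ)
  on-svar (AgreeOn-mono _ ⊆ₛ agree) X∈φ = on-svar agree (⊆ₛ X∈φ)

  AgreeOn-[/ₑ] : ∀ {x φ e e′} (b : Carrier)
               → AgreeOn (ex x φ) e e′ → AgreeOn φ (_[_/ₑ_] M e b x) (_[_/ₑ_] M e′ b x)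
  on-evar (AgreeOn-[/ₑ] {x} b agree) {y} y∈φ with y ≟ x
  ... | yes _   = refl
  ... | no  y≢x = on-evar agree (fe-ex y≢x y∈φ)
  on-svar (AgreeOn-[/ₑ] b agree) X∈φ = on-svar agree (fs-ex X∈φ)

  AgreeOn-[/ₛ] : ∀ {X φ e e′} (B : Carrier → Set)
               → AgreeOn (mu X φ) e e′ → AgreeOn φ (_[_/ₛ_] M e B X) (_[_/ₛ_] M e′ B X)
  on-evar (AgreeOn-[/ₛ] B agree) x∈φ = on-evar agree (fe-mu x∈φ)
  on-svar (AgreeOn-[/ₛ] {X} B agree) {Y} Y∈φ b with Y ≟ X
  ... | yes _   = ⇔-id _
  ... | no  Y≢X = on-svar agree (fs-mu Y≢X Y∈φ) b

  Sat-coincidence : ∀ φ {e e′ a} → AgreeOn φ e e′ → Sat M φ e a → Sat M φ e′ a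
  Sat-coincidence (evar x) agree (lift eₓ≡a) = lift (subst (_≡ _) (on-evar agree fe-var) eₓ≡a)
  Sat-coincidence (svar X) agree (lift a∈X) = lift (Equivalence.to (on-svar agree fs-var _) a∈X)
  Sat-coincidence (sym σ)  agree a∈σ = a∈σ
  Sat-coincidence (app φ ψ) agree (b , c , b∈φ , c∈ψ , a∈bc) =
    b , c , Sat-coincidence φ (AgreeOn-mono fe-appˡ fs-appˡ agree) b∈φ
          , Sat-coincidence ψ (AgreeOn-mono fe-appʳ fs-appʳ agree) c∈ψ , a∈bc
  Sat-coincidence (imp φ ψ) agree a∈φ→ψ (a∈φ , a∉ψ) =
    a∈φ→ψ ( Sat-coincidence φ (AgreeOn-sym (AgreeOn-mono fe-impˡ fs-impˡ agree)) a∈φ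
          , λ a∈ψ → a∉ψ (Sat-coincidence ψ (AgreeOn-mono fe-impʳ fs-impʳ agree) a∈ψ))
  Sat-coincidence (ex x φ) agree (b , a∈φ) = b , Sat-coincidence φ (AgreeOn-[/ₑ] b agree) a∈φ
  Sat-coincidence (mu X φ) agree a∈μ B B-prefixed′ =
    a∈μ B (λ b b∈φ → B-prefixed′ b (Sat-coincidence φ (AgreeOn-[/ₛ] B agree) b∈φ))

  Sat-closed : ∀ {φ} → Closed φ → ∀ {e e′ a} → Sat M φ e a → Sat M φ e′ a
  Sat-closed {φ} (no-evar , no-svar) = Sat-coincidence φ agree
    where
    agree : ∀ {e e′} → AgreeOn φ e e′
    on-evar agree x∈φ = ⊥-elim (no-evar _ x∈φ)
    on-svar agree X∈φ = ⊥-elim (no-svar _ X∈φ)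

  IsPredicate⇒SatAt : ∀ {φ} → IsPredicate φ → ∀ {e a} → Sat M φ e a → SatAt M φ e
  IsPredicate⇒SatAt predicate {e} a∈φ with predicate M e
  ... | inj₁ empty = ⊥-elim (empty _ a∈φ)
  ... | inj₂ full  = full

module _ {Sig : Set} {Γ : Pattern Sig → Set} {φ : Pattern Sig} where

  ⊨l⇒⊨g : Γ ⊨l φ → Γ ⊨g φ
  ⊨l⇒⊨g Γ⊨φ M M⊨Γ e = Γ⊨φ M e (λ γ γ∈Γ → M⊨Γ γ γ∈Γ e)

  ⊨g⇒⊨l : (∀ γ → Γ γ → Closed γ) → Γ ⊨g φ → Γ ⊨l φ
  ⊨g⇒⊨l closed Γ⊨φ M e M⊨Γ[e] =
    Γ⊨φ M (λ γ γ∈Γ _ a → Sat-closed M (closed γ γ∈Γ) (M⊨Γ[e] γ γ∈Γ a)) e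

  ⊨s⇒⊨l : Γ ⊨s φ → Γ ⊨l φ
  ⊨s⇒⊨l Γ⊨φ M e M⊨Γ[e] a = Γ⊨φ M e a (λ γ γ∈Γ → M⊨Γ[e] γ γ∈Γ a)

  ⊨l⇒⊨s : (∀ γ → Γ γ → IsPredicate γ) → Γ ⊨l φ → Γ ⊨s φ
  ⊨l⇒⊨s predicate Γ⊨φ M e a a∈Γ =
    Γ⊨φ M e (λ γ γ∈Γ → IsPredicate⇒SatAt M (predicate γ γ∈Γ) (a∈Γ γ γ∈Γ)) a

mainTheorem17 : {Sig : Set} (Γ : Pattern Sig → Set)
    → (∀ γ → Γ γ → Closed γ × IsPredicate γ)
    → ∀ (φ : Pattern Sig) → ((Γ ⊨g φ) ⇔ (Γ ⊨l φ)) × ((Γ ⊨l φ) ⇔ (Γ ⊨s φ))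
mainTheorem17 Γ closed-predicates φ =
    mk⇔ (⊨g⇒⊨l (λ γ → proj₁ ∘ closed-predicates γ)) ⊨l⇒⊨g
  , mk⇔ (⊨l⇒⊨s (λ γ → proj₂ ∘ closed-predicates γ)) ⊨s⇒⊨l
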